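{- A set-system hypergraph $P$ is projective in $\mathfrak{H}$ (with respect to epimorphisms) if and only if $\epsilon_P(e)=\emptyset$ for all $e\in E(P)$.
   Context: A set-system hypergraph $G$ consists of sets $V(G)$, $E(G)$ and a function $\epsilon_G:E(G)\to\mathcal{P}(V(G))$ (edges may be empty). A morphism $\phi:G\to H$ is a pair of functions $V(\phi):V(G)\to V(H)$, $E(\phi):E(G)\to E(H)$ with $\epsilon_H\circ E(\phi)=\mathcal{P}V(\phi)\circ\epsilon_G$, where $\mathcal{P}f(A)=\{f(a):a\in A\}$. This forms the category $\mathfrak{H}$. (In $\mathfrak{H}$, a morphism is an epimorphism iff both $V(\phi)$ and $E(\phi)$ are surjective.) -}

module Defs where

open import Level using (0ℓ)
open import Data.Product using (Σ; ∃; _×_; _,_; proj₁; proj₂)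
open import Relation.Binary.PropositionalEquality using (_≡_; refl; trans; cong)
open import Relation.Nullary using (¬_)
open import Function using (_∘_)

ℙ : Set → Set₁
ℙ A = A → Set

_≐_ : {A : Set} → ℙ A → ℙ A → Set
S ≐ T = ∀ a → (S a → T a) × (T a → S a)

image : {A B : Set} → (A → B) → ℙ A → ℙ B
image f S b = ∃ λ a → S a × f a ≡ b

record Hypergraph : Set₁ where
  field
    V : Set
    E : Set
    ε : E → ℙ V
open Hypergraph public

record Hom (G H : Hypergraph) : Set₁ where
  field
    vmap : V G → V H
    emap : E G → E H
    comm : ∀ e → ε H (emap e) ≐ image vmap (ε G e)
open Hom public

_∘ₕ_ : {G H K : Hypergraph} → Hom H K → Hom G H → Hom G K
_∘ₕ_ {G} {H} {K} ψ φ = record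
  { vmap = vmap ψ ∘ vmap φ
  ; emap = emap ψ ∘ emap φ
  ; comm = λ e k →
      (λ x → let (h , hx , p) = proj₁ (comm ψ (emap φ e) k) x
                 (g , gx , q) = proj₁ (comm φ e h) hx
             in g , gx , trans (cong (vmap ψ) q) p)
    , (λ { (g , gx , p) → proj₂ (comm ψ (emap φ e) k)
             (vmap φ g , proj₂ (comm φ e (vmap φ g)) (g , gx , refl) , p) })
  }

_≈ₕ_ : {G H : Hypergraph} → Hom G H → Hom G H → Set
φ ≈ₕ ψ = (∀ v → vmap φ v ≡ vmap ψ v) × (∀ e → emap φ e ≡ emap ψ e)

-- epimorphisms of 𝔥: both components surjective (characterisation given in the paper's context)
Epi : {G H : Hypergraph} → Hom G H → Set
Epi {G} {H} φ = (∀ w → ∃ λ v → vmap φ v ≡ w) × (∀ f → ∃ λ e → emap φ e ≡ f)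

Projective : Hypergraph → Set₁
Projective P = ∀ {X Y : Hypergraph} (g : Hom X Y) → Epi g → (f : Hom P Y) →
  ∃ λ (h : Hom P X) → (g ∘ₕ h) ≈ₕ f

AllEdgesEmpty : Hypergraph → Set
AllEdgesEmpty P = ∀ e v → ¬ ε P e v

{-# OPTIONS --safe #-}

-- An edge-empty P lifts through any epimorphism by choosing preimages arbitrarily:
-- morphisms preserve and reflect emptiness of edges, so the chosen edges are empty
-- and nothing else constrains the lift. Conversely, double every vertex of P; the
-- collapse onto P is an epimorphism, so projectivity yields a section s of it. If v
-- lay in an edge e, both copies of v would lie in the edge s(e) = e, hence each would
-- be s(u) for some u ∈ e projecting back to v, i.e. u = v; so s(v) would equal both copies.
module Submission where

open import Defs
open import Data.Bool using (Bool; true; false)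
open import Data.Empty using (⊥-elim)
open import Data.Product using (_×_; _,_; proj₁; proj₂)
open import Function using (id; _∘_)
open import Relation.Binary.PropositionalEquality using (_≡_; _≢_; refl; sym; trans; cong; subst)
open import Relation.Unary using (Empty)

private
  variable
    A B : Set
    G H : Hypergraph

image-empty : {f : A → B} {S : ℙ A} → Empty S → Empty (image f S)
image-empty S-empty _ (a , a∈S , _) = S-empty a a∈S

≐-empty : {S T : ℙ A} → Empty S → Empty T → S ≐ T
≐-empty S-empty T-empty a = (λ a∈S → ⊥-elim (S-empty a a∈S)) , (λ a∈T → ⊥-elim (T-empty a a∈T))

Hom-preserves-empty : (φ : Hom G H) (e : E G) → Empty (ε G e) → Empty (ε H (emap φ e))
Hom-preserves-empty φ e e-empty w w∈φe = image-empty e-empty w (proj₁ (comm φ e w) w∈φe)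

Hom-reflects-empty : (φ : Hom G H) (e : E G) → Empty (ε H (emap φ e)) → Empty (ε G e)
Hom-reflects-empty φ e φe-empty v v∈e =
  φe-empty (vmap φ v) (proj₂ (comm φ e (vmap φ v)) (v , v∈e , refl))

homFromEmptyEdges : (f : V G → V H) (g : E G → E H) →
  AllEdgesEmpty G → (∀ e → Empty (ε H (g e))) → Hom G H
homFromEmptyEdges f g G-empty ge-empty = record
  { vmap = f
  ; emap = g
  ; comm = λ e → ≐-empty (ge-empty e) (image-empty (G-empty e))
  }

allEdgesEmpty⇒projective : (P : Hypergraph) → AllEdgesEmpty P → Projective P
allEdgesEmpty⇒projective P P-empty {X} {Y} g (v-onto , e-onto) f =
  lift , (proj₂ ∘ v-onto ∘ vmap f) , (proj₂ ∘ e-onto ∘ emap f)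
  where
  liftedEdge-empty : ∀ e → Empty (ε X (proj₁ (e-onto (emap f e))))
  liftedEdge-empty e =
    Hom-reflects-empty g (proj₁ (e-onto (emap f e)))
      (subst (λ k → Empty (ε Y k)) (sym (proj₂ (e-onto (emap f e))))
        (Hom-preserves-empty f e (P-empty e)))

  lift : Hom P X
  lift = homFromEmptyEdges (proj₁ ∘ v-onto ∘ vmap f) (proj₁ ∘ e-onto ∘ emap f) P-empty liftedEdge-empty

idₕ : Hom G G
idₕ = record
  { vmap = id
  ; emap = id
  ; comm = λ e v → (λ v∈e → v , v∈e , refl) , λ { (_ , v∈e , refl) → v∈e }
  }

doubled : Hypergraph → Hypergraph
doubled P = record { V = V P × Bool ; E = E P ; ε = λ e → ε P e ∘ proj₁ }

collapse : (P : Hypergraph) → Hom (doubled P) P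
collapse P = record
  { vmap = proj₁
  ; emap = id
  ; comm = λ e v → (λ v∈e → (v , true) , v∈e , refl) , λ { (_ , v∈e , refl) → v∈e }
  }

collapse-epi : (P : Hypergraph) → Epi (collapse P)
collapse-epi P = (λ v → (v , true) , refl) , (λ e → e , refl)

collapse-section⇒allEdgesEmpty : (P : Hypergraph) (s : Hom P (doubled P)) →
  (collapse P ∘ₕ s) ≈ₕ idₕ → AllEdgesEmpty P
collapse-section⇒allEdgesEmpty P s (s-v , s-e) e v v∈e =
  true≢false (trans (sym (copy-of-v true)) (copy-of-v false))
  where
  true≢false : true ≢ false
  true≢false ()

  copy-of-v : ∀ b → proj₂ (vmap s v) ≡ b
  copy-of-v b with proj₁ (comm s e (v , b)) (subst (λ k → ε P k v) (sym (s-e e)) v∈e)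
  ... | u , _ , su≡vb = subst (λ w → proj₂ (vmap s w) ≡ b) u≡v (cong proj₂ su≡vb)
    where
    u≡v : u ≡ v
    u≡v = trans (sym (s-v u)) (cong proj₁ su≡vb)

projective⇒allEdgesEmpty : (P : Hypergraph) → Projective P → AllEdgesEmpty P
projective⇒allEdgesEmpty P P-projective =
  let s , s-section = P-projective (collapse P) (collapse-epi P) idₕ
  in collapse-section⇒allEdgesEmpty P s s-section

mainTheorem5 : (P : Hypergraph) → (Projective P → AllEdgesEmpty P) × (AllEdgesEmpty P → Projective P)
mainTheorem5 P = projective⇒allEdgesEmpty P , allEdgesEmpty⇒projective P
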